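{- Let $\eta_2$ be the error measure defined in the context. For every deterministic online algorithm with predictions $\mathrm{Alg}$ for the WMST problem and every function $f$, there exists a WMST-instance $(G,\hat w,w)$ (together with an order of arrival of the true weights) such that $$\frac{\mathrm{Alg}(\hat w,w)}{\mathrm{Opt}(w)} > f\big(\eta_2(\hat w,w)\big).$$
   Context: WMST problem with predictions (weight-arrival minimum spanning tree): a WMST-instance is a triple $(G,\hat w,w)$ where $G=(V,E)$ is a finite simple connected undirected graph, and $\hat w, w\colon E\to\mathbb{R}^+$ give for each edge a predicted weight $\hat w(e)$ and a true weight $w(e)$. An online algorithm is initially given $G$ and all predicted weights $\hat w$. Then the true weights arrive one at a time, as pairs $(w(e),e)$, each edge exactly once, in an order chosen by an adversary; upon arrival of $(w(e),e)$ the algorithm must irrevocably accept or reject $e$, and the accepted edges must form a spanning tree of $G$. $\mathrm{Alg}(\hat w,w)$ is the total true weight of the tree output by $\mathrm{Alg}$, and for a weight function $x\colon E\to\mathbb{R}^+$, $\mathrm{Opt}(x)$ denotes the minimum weight of a spanning tree of $G$ under $x$. Let $E_o=\{e\in E : \hat w(e)>w(e)\}$ and $E_u=E\setminus E_o$. Define $\eta_2(\hat w,w)=\mathrm{Opt}(x_1)-\mathrm{Opt}(x_2)$, where $x_1(e)=\hat w(e)$ for $e\in E_o$, $x_1(e)=w(e)$ for $e\in E_u$, and $x_2(e)=w(e)$ for $e\in E_o$, $x_2(e)=\hat w(e)$ for $e\in E_u$.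
   Formalization: The function f maps the rationals to the rationals, and the predicted and true weights, both those an algorithm must handle and those of the instance, are positive rationals rather than positive reals. -}

module Defs where

open import Data.Nat using (ℕ; zero; suc)
open import Data.Fin using (Fin)
import Data.Fin.Properties as FinP
open import Data.Bool using (Bool; true; false; if_then_else_)
open import Data.List using (List; []; _∷_; _++_; [_])
open import Data.List.Relation.Unary.Any using (any?)
open import Data.List.Relation.Binary.Permutation.Propositional using (_↭_)
open import Data.List using (allFin)
open import Data.Product using (_×_; _,_; Σ; ∃)
open import Data.Sum using (_⊎_)
open import Relation.Binary.PropositionalEquality using (_≡_; _≢_)
open import Relation.Nullary using (¬_; does)
open import Data.Rational using (ℚ; 0ℚ; _+_; _-_; _*_; _<_; _≤_)
import Data.Rational.Properties as ℚP

data Reach {n m : ℕ} (src tgt : Fin m → Fin n) (S : Fin m → Bool)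
           : Fin n → Fin n → Set where
  here  : ∀ {u} → Reach src tgt S u u
  fwd   : ∀ {u} e → S e ≡ true → Reach src tgt S u (src e)
        → Reach src tgt S u (tgt e)
  bwd   : ∀ {u} e → S e ≡ true → Reach src tgt S u (tgt e)
        → Reach src tgt S u (src e)

allEdges : {m : ℕ} → Fin m → Bool
allEdges _ = true

record Graph : Set where
  field
    n : ℕ
    m : ℕ
    src : Fin m → Fin n
    tgt : Fin m → Fin n
    loopless : ∀ e → src e ≢ tgt e
    simple : ∀ e e' → ((src e ≡ src e' × tgt e ≡ tgt e')
                      ⊎ (src e ≡ tgt e' × tgt e ≡ src e')) → e ≡ e'
    connected : ∀ u v → Reach src tgt allEdges u v

open Graph public

Weights : Graph → Set
Weights G = Fin (m G) → ℚ

Positive : (G : Graph) → Weights G → Set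
Positive G x = ∀ e → 0ℚ < x e

without : {m : ℕ} → (Fin m → Bool) → Fin m → Fin m → Bool
without S e e' = if does (e FinP.≟ e') then false else S e'

IsSpanningTree : (G : Graph) → (Fin (m G) → Bool) → Set
IsSpanningTree G S =
  (∀ u v → Reach (src G) (tgt G) S u v)
  × (∀ e → S e ≡ true → ¬ Reach (src G) (tgt G) (without S e) (src G e) (tgt G e))

sumFin : (k : ℕ) → (Fin k → ℚ) → ℚ
sumFin zero f = 0ℚ
sumFin (suc k) f = f Fin.zero + sumFin k (λ i → f (Fin.suc i))

weightOf : (G : Graph) → Weights G → (Fin (m G) → Bool) → ℚ
weightOf G x S = sumFin (m G) (λ e → if S e then x e else 0ℚ)

IsOpt : (G : Graph) → Weights G → ℚ → Set
IsOpt G x c =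
  (Σ (Fin (m G) → Bool) λ S → IsSpanningTree G S × weightOf G x S ≡ c)
  × (∀ T → IsSpanningTree G T → c ≤ weightOf G x T)

-- Given G, the predictions ŵ, the history of arrivals so far (pairs
-- (w(e), e), in order of arrival) and the current arrival (w(e), e),
-- it decides to accept (true) or reject (false) e.  Its own past
-- decisions are a deterministic function of these data.
OnlineAlg : Set
OnlineAlg = (G : Graph) → Weights G → List (ℚ × Fin (m G)) → ℚ × Fin (m G) → Bool

runFrom : (A : OnlineAlg) (G : Graph) (ŵ w : Weights G)
        → List (ℚ × Fin (m G)) → List (Fin (m G)) → List (Fin (m G))
runFrom A G ŵ w hist [] = []
runFrom A G ŵ w hist (e ∷ es) =
  if A G ŵ hist (w e , e)
  then e ∷ runFrom A G ŵ w (hist ++ [ (w e , e) ]) es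
  else runFrom A G ŵ w (hist ++ [ (w e , e) ]) es

accepted : (A : OnlineAlg) (G : Graph) (ŵ w : Weights G)
         → List (Fin (m G)) → Fin (m G) → Bool
accepted A G ŵ w order e = does (any? (e FinP.≟_) (runFrom A G ŵ w [] order))

IsOrder : (G : Graph) → List (Fin (m G)) → Set
IsOrder G order = order ↭ allFin (m G)

ValidAlg : OnlineAlg → Set
ValidAlg A = ∀ (G : Graph) (ŵ w : Weights G) → Positive G ŵ → Positive G w
           → (order : List (Fin (m G))) → IsOrder G order
           → IsSpanningTree G (accepted A G ŵ w order)

algCost : (A : OnlineAlg) (G : Graph) (ŵ w : Weights G) → List (Fin (m G)) → ℚ
algCost A G ŵ w order = weightOf G w (accepted A G ŵ w order)

-- x₁, x₂ from the definition of η₂ (E_o = {e | ŵ e > w e})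
x₁ : (G : Graph) → Weights G → Weights G → Weights G
x₁ G ŵ w e = if does (w e ℚP.<? ŵ e) then ŵ e else w e

x₂ : (G : Graph) → Weights G → Weights G → Weights G
x₂ G ŵ w e = if does (w e ℚP.<? ŵ e) then w e else ŵ e

{-# OPTIONS --safe #-}
-- Predict weight 1 on every edge of a triangle and keep all true weights
-- at least 1; then x₁ = w and x₂ = ŵ, so η₂ = Opt(w) − 2.  Edge e₀ arrives
-- with weight 1, then e₁ with a weight B > 2·f(0).  If the algorithm drops
-- e₀, let e₂ weigh B: it pays 1 + B while Opt(w) = 2.  If it keeps e₀ and
-- e₁, let e₂ weigh 1: again it pays 1 + B against Opt(w) = 2.  If it keeps
-- e₀ but drops e₁, every weight L ≥ B of e₂ gives Opt(w) = 1 + B, so η₂ is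
-- already fixed, and it pays 1 + L, which L can make exceed f(η₂)·(1 + B).
module Submission where

open import Defs
open import Data.Nat using (ℕ)
open import Data.Fin using (Fin; zero; suc)
import Data.Fin.Properties as FinP
open import Data.Bool using (Bool; true; false; if_then_else_)
open import Data.Bool.Properties using (not-¬)
open import Data.List using (List; []; _∷_; _++_; [_]; map)
open import Data.List.Properties using (++-assoc; ++-identityʳ)
open import Data.List.Membership.Propositional using (_∈_; _∉_)
open import Data.List.Relation.Unary.Any using (here; there; any?)
open import Data.List.Relation.Binary.Permutation.Propositional using (↭-refl)
open import Data.Product using (Σ; _×_; _,_; proj₁; proj₂)
open import Data.Sum using (_⊎_; inj₁; inj₂)
open import Data.Empty using (⊥-elim)
open import Function using (_∘_)
open import Relation.Nullary using (¬_; does; yes; no; contradiction)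
open import Relation.Nullary.Decidable using (dec-true; dec-false)
open import Relation.Binary.PropositionalEquality
  using (_≡_; _≢_; refl; sym; trans; cong; cong₂; subst; subst₂)
open import Data.Rational using (ℚ; 0ℚ; 1ℚ; _+_; _-_; -_; _*_; _<_; _≤_; _⊔_)
import Data.Rational.Properties as ℚP

Isolated : ∀ {n m} (src tgt : Fin m → Fin n) → (Fin m → Bool) → Fin n → Set
Isolated src tgt S x = ∀ e → S e ≡ true → src e ≢ x × tgt e ≢ x

module _ {n m : ℕ} {src tgt : Fin m → Fin n} {S : Fin m → Bool} where

  reach-trans : ∀ {u v w} → Reach src tgt S u v → Reach src tgt S v w
              → Reach src tgt S u w
  reach-trans p here        = p
  reach-trans p (fwd e s q) = fwd e s (reach-trans p q)
  reach-trans p (bwd e s q) = bwd e s (reach-trans p q)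

  reach-sym : ∀ {u v} → Reach src tgt S u v → Reach src tgt S v u
  reach-sym here        = here
  reach-sym (fwd e s p) = reach-trans (bwd e s here) (reach-sym p)
  reach-sym (bwd e s p) = reach-trans (fwd e s here) (reach-sym p)

  connected-from : ∀ r → (∀ v → Reach src tgt S r v)
                 → ∀ u v → Reach src tgt S u v
  connected-from r reach u v = reach-trans (reach-sym (reach u)) (reach v)

  reach-isolated : ∀ {x u v} → Isolated src tgt S x → Reach src tgt S u v
                 → u ≡ x ⊎ v ≡ x → u ≡ v
  reach-isolated iso here        _          = refl
  reach-isolated iso (fwd e s r) (inj₁ u≡x) =
    ⊥-elim (proj₁ (iso e s) (trans (sym (reach-isolated iso r (inj₁ u≡x))) u≡x))
  reach-isolated iso (fwd e s r) (inj₂ v≡x) = ⊥-elim (proj₂ (iso e s) v≡x)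
  reach-isolated iso (bwd e s r) (inj₁ u≡x) =
    ⊥-elim (proj₂ (iso e s) (trans (sym (reach-isolated iso r (inj₁ u≡x))) u≡x))
  reach-isolated iso (bwd e s r) (inj₂ v≡x) = ⊥-elim (proj₁ (iso e s) v≡x)

  connected-isolated : (∀ u v → Reach src tgt S u v) → ∀ {x} → Isolated src tgt S x
                     → ∀ u → u ≡ x
  connected-isolated conn iso u = reach-isolated iso (conn u _) (inj₂ refl)

isolated-endpoint-unreachable : ∀ (G : Graph) {S} e {x} → Isolated (src G) (tgt G) S x
  → src G e ≡ x ⊎ tgt G e ≡ x → ¬ Reach (src G) (tgt G) S (src G e) (tgt G e)
isolated-endpoint-unreachable G e iso endpoint r =
  loopless G e (reach-isolated iso r endpoint)

sumFin-cong : ∀ {k} {f g : Fin k → ℚ} → (∀ i → f i ≡ g i) → sumFin k f ≡ sumFin k g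
sumFin-cong {ℕ.zero} f≗g = refl
sumFin-cong {ℕ.suc k} f≗g = cong₂ _+_ (f≗g zero) (sumFin-cong (f≗g ∘ suc))

weightOf-cong : ∀ (G : Graph) {x y : Weights G} {S T : Fin (m G) → Bool}
              → (∀ e → x e ≡ y e) → (∀ e → S e ≡ T e)
              → weightOf G x S ≡ weightOf G y T
weightOf-cong G x≗y S≗T =
  sumFin-cong (λ e → cong₂ (λ b q → if b then q else 0ℚ) (S≗T e) (x≗y e))

isOpt-cong : ∀ (G : Graph) {x y : Weights G} {c} → (∀ e → x e ≡ y e)
           → IsOpt G x c → IsOpt G y c
isOpt-cong G x≗y ((S , tree , wS≡c) , minimal) =
    (S , tree , trans (sym (weightOf-cong G x≗y (λ _ → refl))) wS≡c)
  , λ T t → subst (_ ≤_) (weightOf-cong G x≗y (λ _ → refl)) (minimal T t)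

sumFin-without : ∀ {k} (f : Fin k → ℚ) S e
  → sumFin k (λ i → if without S e i then f i else 0ℚ) + (if S e then f e else 0ℚ)
    ≡ sumFin k (λ i → if S i then f i else 0ℚ)
sumFin-without {ℕ.suc k} f S zero =
  trans (cong (_+ head) (ℚP.+-identityˡ tail)) (ℚP.+-comm tail head)
  where
  head = if S zero then f zero else 0ℚ
  tail = sumFin k (λ i → if S (suc i) then f (suc i) else 0ℚ)
sumFin-without {ℕ.suc k} f S (suc e) =
  trans (ℚP.+-assoc head _ _)
        (cong (head +_) (sumFin-without (f ∘ suc) (S ∘ suc) e))
  where
  head = if S zero then f zero else 0ℚ

allBut : ∀ {m} → Fin m → Fin m → Bool
allBut = without allEdges

allBut-false : ∀ {m} {e e' : Fin m} → allBut e e' ≡ false → e ≡ e'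
allBut-false {e = e} {e'} eq with e FinP.≟ e'
... | yes e≡e' = e≡e'
... | no  _    = contradiction eq λ ()

+-cancelʳ-≤ : ∀ {p q} r → p + r ≤ q + r → p ≤ q
+-cancelʳ-≤ {p} {q} r p+r≤q+r =
  subst₂ _≤_ (p+r-r≡p p) (p+r-r≡p q) (ℚP.+-monoˡ-≤ (- r) p+r≤q+r)
  where
  p+r-r≡p : ∀ p → p + r - r ≡ p
  p+r-r≡p p = trans (ℚP.+-assoc p r (- r))
                    (trans (cong (p +_) (ℚP.+-inverseʳ r)) (ℚP.+-identityʳ p))

allBut-lighter : ∀ (G : Graph) (x : Weights G) {e e'} → x e' ≤ x e
               → weightOf G x (allBut e) ≤ weightOf G x (allBut e')
allBut-lighter G x {e} {e'} xe'≤xe = +-cancelʳ-≤ (x e') (begin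
  weightOf G x (allBut e) + x e'  ≤⟨ ℚP.+-monoʳ-≤ (weightOf G x (allBut e)) xe'≤xe ⟩
  weightOf G x (allBut e) + x e   ≡⟨ sumFin-without x allEdges e ⟩
  weightOf G x allEdges           ≡⟨ sumFin-without x allEdges e' ⟨
  weightOf G x (allBut e') + x e' ∎)
  where open ℚP.≤-Reasoning

≤⇒≯ : ∀ {p q} → p ≤ q → ¬ q < p
≤⇒≯ p≤q q<p = ℚP.<-irrefl refl (ℚP.<-≤-trans q<p p≤q)

x₁≗w : ∀ (G : Graph) {ŵ w : Weights G} → (∀ e → ŵ e ≤ w e)
     → ∀ e → x₁ G ŵ w e ≡ w e
x₁≗w G {ŵ} {w} ŵ≤w e =
  cong (λ b → if b then ŵ e else w e) (dec-false (w e ℚP.<? ŵ e) (≤⇒≯ (ŵ≤w e)))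

x₂≗ŵ : ∀ (G : Graph) {ŵ w : Weights G} → (∀ e → ŵ e ≤ w e)
     → ∀ e → x₂ G ŵ w e ≡ ŵ e
x₂≗ŵ G {ŵ} {w} ŵ≤w e =
  cong (λ b → if b then w e else ŵ e) (dec-false (w e ℚP.<? ŵ e) (≤⇒≯ (ŵ≤w e)))

arrivals : (G : Graph) → Weights G → List (Fin (m G)) → List (ℚ × Fin (m G))
arrivals G w = map (λ e → w e , e)

module _ (A : OnlineAlg) (G : Graph) (ŵ w : Weights G) where

  private
    run = runFrom A G ŵ w

  run-⊆ : ∀ {e} hist es → e ∈ run hist es → e ∈ es
  run-⊆ hist (x ∷ es) e∈ with A G ŵ hist (w x , x)
  run-⊆ hist (x ∷ es) (here e≡x) | true  = here e≡x
  run-⊆ hist (x ∷ es) (there e∈) | true  = there (run-⊆ _ es e∈)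
  ... | false = there (run-⊆ _ es e∈)

  any-≟-skip : ∀ {e x : Fin (m G)} xs → e ≢ x
             → does (any? (e FinP.≟_) (x ∷ xs)) ≡ does (any? (e FinP.≟_) xs)
  any-≟-skip {e} {x} xs e≢x rewrite dec-false (e FinP.≟ x) e≢x = refl

  run-decision : ∀ {e es} hist pre → e ∉ pre → e ∉ es
    → does (any? (e FinP.≟_) (run hist (pre ++ e ∷ es)))
      ≡ A G ŵ (hist ++ arrivals G w pre) (w e , e)
  run-decision {e} {es} hist [] _ e∉es rewrite ++-identityʳ hist
    with A G ŵ hist (w e , e)
  ... | true  = dec-true (any? (e FinP.≟_) (e ∷ run _ es)) (here refl)
  ... | false = dec-false (any? (e FinP.≟_) (run _ es)) (e∉es ∘ run-⊆ _ es)
  run-decision {e} {es} hist (x ∷ pre) e∉x∷pre e∉es =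
    trans (skip (A G ŵ hist (w x , x)))
      (trans (run-decision (hist ++ [ w x , x ]) pre (e∉x∷pre ∘ there) e∉es)
             (cong (λ h → A G ŵ h (w e , e)) (++-assoc hist _ _)))
    where
    rest = run (hist ++ [ w x , x ]) (pre ++ e ∷ es)
    skip : ∀ b → does (any? (e FinP.≟_) (if b then x ∷ rest else rest))
                 ≡ does (any? (e FinP.≟_) rest)
    skip true  = any-≟-skip rest (e∉x∷pre ∘ here)
    skip false = refl

  accepted-decision : ∀ pre e es → e ∉ pre → e ∉ es
    → accepted A G ŵ w (pre ++ e ∷ es) e ≡ A G ŵ (arrivals G w pre) (w e , e)
  accepted-decision pre e es = run-decision [] pre

pattern v₀ = zero
pattern v₁ = suc zero
pattern v₂ = suc (suc zero)

pattern e₀ = zero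
pattern e₁ = suc zero
pattern e₂ = suc (suc zero)

triangle-src triangle-tgt : Fin 3 → Fin 3
triangle-src e₀ = v₀
triangle-src e₁ = v₁
triangle-src e₂ = v₀
triangle-tgt e₀ = v₁
triangle-tgt e₁ = v₂
triangle-tgt e₂ = v₂

triangle-simple : ∀ e e'
  → ((triangle-src e ≡ triangle-src e' × triangle-tgt e ≡ triangle-tgt e')
     ⊎ (triangle-src e ≡ triangle-tgt e' × triangle-tgt e ≡ triangle-src e'))
  → e ≡ e'
triangle-simple e₀ e₀ _ = refl
triangle-simple e₁ e₁ _ = refl
triangle-simple e₂ e₂ _ = refl
triangle-simple e₀ e₁ (inj₁ (() , _))
triangle-simple e₀ e₁ (inj₂ (() , _))
triangle-simple e₀ e₂ (inj₁ (_ , ()))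
triangle-simple e₀ e₂ (inj₂ (() , _))
triangle-simple e₁ e₀ (inj₁ (() , _))
triangle-simple e₁ e₀ (inj₂ (_ , ()))
triangle-simple e₁ e₂ (inj₁ (() , _))
triangle-simple e₁ e₂ (inj₂ (() , _))
triangle-simple e₂ e₀ (inj₁ (_ , ()))
triangle-simple e₂ e₀ (inj₂ (() , _))
triangle-simple e₂ e₁ (inj₁ (() , _))
triangle-simple e₂ e₁ (inj₂ (() , _))

triangle : Graph
triangle = record
  { n         = 3
  ; m         = 3
  ; src       = triangle-src
  ; tgt       = triangle-tgt
  ; loopless  = λ { e₀ () ; e₁ () ; e₂ () }
  ; simple    = triangle-simple
  ; connected = connected-from v₀
      λ { v₀ → here ; v₁ → fwd e₀ refl here ; v₂ → fwd e₂ refl here }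
  }

module _ {T : Fin 3 → Bool} where

  spanningTree-noIsolated : IsSpanningTree triangle T
                          → ∀ {x} → ¬ Isolated triangle-src triangle-tgt T x
  spanningTree-noIsolated (conn , _) iso with connected-isolated conn iso v₀
                                            | connected-isolated conn iso v₁
  ... | refl | ()

  spanningTree-noCycle : IsSpanningTree triangle T
    → T e₀ ≡ true → T e₁ ≡ true → T e₂ ≡ false
  spanningTree-noCycle (_ , acyclic) t₀ t₁ with T e₂ in t₂
  ... | false = refl
  ... | true  = ⊥-elim (acyclic e₀ t₀ (bwd e₁ t₁ (fwd e₂ t₂ here)))

  spanningTree⇒allBut : IsSpanningTree triangle T
    → Σ (Fin 3) λ e → ∀ e' → T e' ≡ allBut e e'
  spanningTree⇒allBut tree with T e₀ in t₀ | T e₁ in t₁ | T e₂ in t₂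
  ... | true  | true  | true  = ⊥-elim (not-¬ t₂ (spanningTree-noCycle tree t₀ t₁))
  ... | true  | true  | false = e₂ , λ { e₀ → t₀ ; e₁ → t₁ ; e₂ → t₂ }
  ... | true  | false | true  = e₁ , λ { e₀ → t₀ ; e₁ → t₁ ; e₂ → t₂ }
  ... | false | true  | true  = e₀ , λ { e₀ → t₀ ; e₁ → t₁ ; e₂ → t₂ }
  ... | false | false | _     = ⊥-elim (spanningTree-noIsolated tree {v₁} λ
    { e₀ s → ⊥-elim (not-¬ s t₀) ; e₁ s → ⊥-elim (not-¬ s t₁)
    ; e₂ _ → (λ ()) , (λ ()) })
  ... | false | true  | false = ⊥-elim (spanningTree-noIsolated tree {v₀} λ
    { e₀ s → ⊥-elim (not-¬ s t₀) ; e₂ s → ⊥-elim (not-¬ s t₂)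
    ; e₁ _ → (λ ()) , (λ ()) })
  ... | true  | false | false = ⊥-elim (spanningTree-noIsolated tree {v₂} λ
    { e₁ s → ⊥-elim (not-¬ s t₁) ; e₂ s → ⊥-elim (not-¬ s t₂)
    ; e₀ _ → (λ ()) , (λ ()) })

  spanningTree-missing : IsSpanningTree triangle T → ∀ {e} → T e ≡ false
    → ∀ e' → T e' ≡ allBut e e'
  spanningTree-missing tree {e} Te≡false with spanningTree⇒allBut tree
  ... | d , T≗allBut =
    subst (λ d → ∀ e' → T e' ≡ allBut d e')
          (allBut-false {e = d} (trans (sym (T≗allBut e)) Te≡false)) T≗allBut

-- Deleting a second edge e' isolates the vertex that e' shares with e.
allBut-spanningTree : ∀ e → IsSpanningTree triangle (allBut e)
allBut-spanningTree e₀ =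
    connected-from v₀
      (λ { v₀ → here ; v₁ → bwd e₁ refl (fwd e₂ refl here) ; v₂ → fwd e₂ refl here })
  , λ { e₀ ()
      ; e₁ _ → isolated-endpoint-unreachable triangle e₁
                 (λ { e₀ () ; e₁ () ; e₂ _ → (λ ()) , (λ ()) }) (inj₁ refl)
      ; e₂ _ → isolated-endpoint-unreachable triangle e₂
                 (λ { e₀ () ; e₁ _ → (λ ()) , (λ ()) ; e₂ () }) (inj₁ refl) }
allBut-spanningTree e₁ =
    connected-from v₀
      (λ { v₀ → here ; v₁ → fwd e₀ refl here ; v₂ → fwd e₂ refl here })
  , λ { e₀ _ → isolated-endpoint-unreachable triangle e₀
                 (λ { e₀ () ; e₁ () ; e₂ _ → (λ ()) , (λ ()) }) (inj₂ refl)
      ; e₁ ()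
      ; e₂ _ → isolated-endpoint-unreachable triangle e₂
                 (λ { e₀ _ → (λ ()) , (λ ()) ; e₁ () ; e₂ () }) (inj₂ refl) }
allBut-spanningTree e₂ =
    connected-from v₀
      (λ { v₀ → here ; v₁ → fwd e₀ refl here ; v₂ → fwd e₁ refl (fwd e₀ refl here) })
  , λ { e₀ _ → isolated-endpoint-unreachable triangle e₀
                 (λ { e₀ () ; e₁ _ → (λ ()) , (λ ()) ; e₂ () }) (inj₁ refl)
      ; e₁ _ → isolated-endpoint-unreachable triangle e₁
                 (λ { e₀ _ → (λ ()) , (λ ()) ; e₁ () ; e₂ () }) (inj₂ refl)
      ; e₂ () }

triangle-opt : ∀ (x : Weights triangle) e → (∀ e' → x e' ≤ x e)
             → IsOpt triangle x (weightOf triangle x (allBut e))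
triangle-opt x e heaviest =
    (allBut e , allBut-spanningTree e , refl)
  , λ T tree → let d , T≗allBut = spanningTree⇒allBut tree in
      ℚP.≤-trans (allBut-lighter triangle x (heaviest d))
                 (ℚP.≤-reflexive (weightOf-cong triangle {x} (λ _ → refl) (sym ∘ T≗allBut)))

module _ (x : Weights triangle) where

  weightOf-allBut₀ : weightOf triangle x (allBut e₀) ≡ x e₁ + x e₂
  weightOf-allBut₀ = trans (ℚP.+-identityˡ _) (cong (x e₁ +_) (ℚP.+-identityʳ (x e₂)))

  weightOf-allBut₁ : weightOf triangle x (allBut e₁) ≡ x e₀ + x e₂
  weightOf-allBut₁ =
    cong (x e₀ +_) (trans (ℚP.+-identityˡ _) (ℚP.+-identityʳ (x e₂)))

  weightOf-allBut₂ : weightOf triangle x (allBut e₂) ≡ x e₀ + x e₁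
  weightOf-allBut₂ =
    cong (x e₀ +_) (trans (cong (x e₁ +_) (ℚP.+-identityʳ 0ℚ)) (ℚP.+-identityʳ (x e₁)))

0<1 : 0ℚ < 1ℚ
0<1 = ℚP.positive⁻¹ 1ℚ

p<1+p : ∀ p → p < 1ℚ + p
p<1+p p = subst (_< 1ℚ + p) (ℚP.+-identityˡ p) (ℚP.+-monoˡ-< p 0<1)

<⇒<1+ : ∀ {q p} → q < p → q < 1ℚ + p
<⇒<1+ {p = p} q<p = ℚP.<-trans q<p (p<1+p p)

0<1+ : ∀ {p} → 1ℚ ≤ p → 0ℚ < 1ℚ + p
0<1+ 1≤p = <⇒<1+ (ℚP.<-≤-trans 0<1 1≤p)

exceeds : ∀ q r → Σ ℚ λ L → q < L × r ≤ L
exceeds q r =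
    1ℚ + (q ⊔ r)
  , ℚP.≤-<-trans (ℚP.p≤p⊔q q r) (p<1+p _)
  , ℚP.≤-trans (ℚP.p≤q⊔p q r) (ℚP.<⇒≤ (p<1+p _))

ones : Weights triangle
ones _ = 1ℚ

weights : ℚ → ℚ → ℚ → Weights triangle
weights a b c e₀ = a
weights a b c e₁ = b
weights a b c e₂ = c

arrivalOrder : List (Fin 3)
arrivalOrder = e₀ ∷ e₁ ∷ e₂ ∷ []

two : ℚ
two = 1ℚ + 1ℚ

ones-opt : IsOpt triangle ones two
ones-opt = subst (IsOpt triangle ones) (weightOf-allBut₂ ones)
             (triangle-opt ones e₂ (λ _ → ℚP.≤-refl))

LowerBoundInstance : OnlineAlg → (ℚ → ℚ) → Set
LowerBoundInstance A f =
  Σ Graph λ G → Σ (Weights G) λ ŵ → Σ (Weights G) λ w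
  → Σ (List (Fin (m G))) λ order
  → Σ ℚ λ opt → Σ ℚ λ opt₁ → Σ ℚ λ opt₂
  → Positive G ŵ × Positive G w × IsOrder G order
    × IsOpt G w opt × IsOpt G (x₁ G ŵ w) opt₁ × IsOpt G (x₂ G ŵ w) opt₂
    × 0ℚ < opt
    × f (opt₁ - opt₂) * opt < algCost A G ŵ w order

module Adversary (A : OnlineAlg) (valid : ValidAlg A) (f : ℚ → ℚ) where

  module _ (w : Weights triangle) (1≤w : ∀ e → 1ℚ ≤ w e) where

    private
      T = accepted A triangle ones w arrivalOrder
      tree = valid triangle ones w (λ _ → 0<1) (λ e → ℚP.<-≤-trans 0<1 (1≤w e))
                   arrivalOrder ↭-refl

    first-decision : T e₀ ≡ A triangle ones [] (w e₀ , e₀)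
    first-decision = accepted-decision A triangle ones w [] e₀ (e₁ ∷ e₂ ∷ [])
      (λ ()) (λ { (here ()) ; (there (here ())) ; (there (there ())) })

    second-decision : T e₁ ≡ A triangle ones [ w e₀ , e₀ ] (w e₁ , e₁)
    second-decision = accepted-decision A triangle ones w (e₀ ∷ []) e₁ (e₂ ∷ [])
      (λ { (here ()) ; (there ()) }) (λ { (here ()) ; (there ()) })

    algCost-dropping : ∀ {e} → T e ≡ false
                     → algCost A triangle ones w arrivalOrder ≡ weightOf triangle w (allBut e)
    algCost-dropping Te≡false =
      weightOf-cong triangle {w} (λ _ → refl) (spanningTree-missing tree Te≡false)

    algCost-keeping : T e₀ ≡ true → T e₁ ≡ true
                    → algCost A triangle ones w arrivalOrder ≡ weightOf triangle w (allBut e₂)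
    algCost-keeping T₀ T₁ = algCost-dropping (spanningTree-noCycle tree T₀ T₁)

    instanceFor : ∀ opt → IsOpt triangle w opt → 0ℚ < opt
                → f (opt - two) * opt < algCost A triangle ones w arrivalOrder
                → LowerBoundInstance A f
    instanceFor opt w-opt 0<opt beaten =
        triangle , ones , w , arrivalOrder , opt , opt , two
      , (λ _ → 0<1) , (λ e → ℚP.<-≤-trans 0<1 (1≤w e)) , ↭-refl
      , w-opt
      , isOpt-cong triangle (sym ∘ x₁≗w triangle 1≤w) w-opt
      , isOpt-cong triangle (sym ∘ x₂≗ŵ triangle 1≤w) ones-opt
      , 0<opt
      , beaten

  B : ℚ
  B = proj₁ (exceeds (f (two - two) * two) 1ℚ)

  B-exceeds : f (two - two) * two < B
  B-exceeds = proj₁ (proj₂ (exceeds (f (two - two) * two) 1ℚ))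

  1≤B : 1ℚ ≤ B
  1≤B = proj₂ (proj₂ (exceeds (f (two - two) * two) 1ℚ))

  rejectsFirst : A triangle ones [] (1ℚ , e₀) ≡ false → LowerBoundInstance A f
  rejectsFirst d₀ =
    instanceFor w 1≤w two w-opt (0<1+ ℚP.≤-refl)
      (subst (f (two - two) * two <_) (sym cost) (<⇒<1+ B-exceeds))
    where
    w = weights 1ℚ 1ℚ B
    1≤w : ∀ e → 1ℚ ≤ w e
    1≤w = λ { e₀ → ℚP.≤-refl ; e₁ → ℚP.≤-refl ; e₂ → 1≤B }
    w-opt : IsOpt triangle w two
    w-opt = subst (IsOpt triangle w) (weightOf-allBut₂ w)
              (triangle-opt w e₂ λ { e₀ → 1≤B ; e₁ → 1≤B ; e₂ → ℚP.≤-refl })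
    cost : algCost A triangle ones w arrivalOrder ≡ 1ℚ + B
    cost = trans (algCost-dropping w 1≤w (trans (first-decision w 1≤w) d₀))
                 (weightOf-allBut₀ w)

  acceptsFirstTwo : A triangle ones [] (1ℚ , e₀) ≡ true
                  → A triangle ones [ 1ℚ , e₀ ] (B , e₁) ≡ true
                  → LowerBoundInstance A f
  acceptsFirstTwo d₀ d₁ =
    instanceFor w 1≤w two w-opt (0<1+ ℚP.≤-refl)
      (subst (f (two - two) * two <_) (sym cost) (<⇒<1+ B-exceeds))
    where
    w = weights 1ℚ B 1ℚ
    1≤w : ∀ e → 1ℚ ≤ w e
    1≤w = λ { e₀ → ℚP.≤-refl ; e₁ → 1≤B ; e₂ → ℚP.≤-refl }
    w-opt : IsOpt triangle w two
    w-opt = subst (IsOpt triangle w) (weightOf-allBut₁ w)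
              (triangle-opt w e₁ λ { e₀ → 1≤B ; e₁ → ℚP.≤-refl ; e₂ → 1≤B })
    cost : algCost A triangle ones w arrivalOrder ≡ 1ℚ + B
    cost = trans (algCost-keeping w 1≤w (trans (first-decision w 1≤w) d₀)
                                        (trans (second-decision w 1≤w) d₁))
                 (weightOf-allBut₂ w)

  rejectsSecond : A triangle ones [ 1ℚ , e₀ ] (B , e₁) ≡ false
                → LowerBoundInstance A f
  rejectsSecond d₁ =
    instanceFor w 1≤w (1ℚ + B) w-opt (0<1+ 1≤B)
      (subst (bound <_) (sym cost) (<⇒<1+ L-exceeds))
    where
    bound = f ((1ℚ + B) - two) * (1ℚ + B)
    L = proj₁ (exceeds bound B)
    L-exceeds : bound < L
    L-exceeds = proj₁ (proj₂ (exceeds bound B))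
    B≤L : B ≤ L
    B≤L = proj₂ (proj₂ (exceeds bound B))
    w = weights 1ℚ B L
    1≤w : ∀ e → 1ℚ ≤ w e
    1≤w = λ { e₀ → ℚP.≤-refl ; e₁ → 1≤B ; e₂ → ℚP.≤-trans 1≤B B≤L }
    w-opt : IsOpt triangle w (1ℚ + B)
    w-opt = subst (IsOpt triangle w) (weightOf-allBut₂ w)
              (triangle-opt w e₂ λ { e₀ → ℚP.≤-trans 1≤B B≤L ; e₁ → B≤L ; e₂ → ℚP.≤-refl })
    cost : algCost A triangle ones w arrivalOrder ≡ 1ℚ + L
    cost = trans (algCost-dropping w 1≤w (trans (second-decision w 1≤w) d₁))
                 (weightOf-allBut₁ w)

  lowerBoundInstance : LowerBoundInstance A f
  lowerBoundInstance with A triangle ones [] (1ℚ , e₀) in d₀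
  ... | false = rejectsFirst d₀
  ... | true with A triangle ones [ 1ℚ , e₀ ] (B , e₁) in d₁
  ...   | true  = acceptsFirstTwo d₀ d₁
  ...   | false = rejectsSecond d₁

mainTheorem1 : (A : OnlineAlg) → ValidAlg A → (f : ℚ → ℚ)
    → Σ Graph λ G → Σ (Weights G) λ ŵ → Σ (Weights G) λ w
      → Σ (List (Fin (m G))) λ order
      → Σ ℚ λ opt → Σ ℚ λ opt₁ → Σ ℚ λ opt₂
      → Positive G ŵ × Positive G w × IsOrder G order
        × IsOpt G w opt × IsOpt G (x₁ G ŵ w) opt₁ × IsOpt G (x₂ G ŵ w) opt₂
        × 0ℚ < opt
        × f (opt₁ - opt₂) * opt < algCost A G ŵ w order
mainTheorem1 A valid f = Adversary.lowerBoundInstance A valid f
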